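{- Let $E,G$ be admissible $A$-module schemes over $S$ with $\varphi_E(t)=\pi\tau^0+\sum_{j\ge1}a_j\tau^j$ and $\varphi_G(t)=\pi\tau^0+\sum_{j\ge1}c_j\tau^j$, and let $f=\sum_{i\ge0}b_i\tau^i\in R\{\tau\}^\wedge$ be an $A$-linear morphism $E\to G$. Then $f$ is determined by the induced morphism on tangent spaces (i.e. by $b_0$); more precisely, for every $r\ge1$ one has, in $K=R[1/\pi]$, $$b_r=(\pi-\pi^{q^r})^{ -1}\sum_{i=0}^{r-1}\big(b_ia_{r-i}^{q^i}-c_{r-i}b_i^{q^{r-i}}\big).$$
   Context: Let $q=p^h$, $A=\mathcal O(X\setminus\{\infty\})$ for a projective, geometrically connected, smooth curve $X$ over $\mathbb F_q$ and $\infty\in X(\mathbb F_q)$; $\mathfrak p\subset A$ a maximal ideal, $\hat A$ the $\mathfrak p$-adic completion, $t\in\mathfrak p\setminus\mathfrak p^2$ with image $\pi\in\hat A$. $R$ is an $\hat A$-algebra which is $\pi$-adically complete and $\pi$-torsion free, $\theta:A\to R$ the structure map, $S=\mathrm{Spf}R$, $K=R[1/\pi]$. $\hat{\mathbb G}_a=\mathrm{Spf}R\langle x\rangle$. $R\{\tau\}^\wedge$ is the set of sums $\sum_{i\ge0}b_i\tau^i$ with $b_i\in R$, $b_i\to0$ $\pi$-adically, acting on $\hat{\mathbb G}_a$ by $x\mapsto\sum b_ix^{q^i}$, with composition $b\tau^i\circ c\tau^j=bc^{q^i}\tau^{i+j}$. An admissible $A$-module scheme over $S$ is $\hat{\mathbb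 G}_a$ with a ring homomorphism $\varphi_E:A\to R\{\tau\}^\wedge$ such that the $\tau^0$-coefficient of $\varphi_E(a)$ is $\theta(a)$ for all $a\in A$. An $A$-linear morphism $E\to G$ is an $f\in R\{\tau\}^\wedge$ with $f\circ\varphi_E(a)=\varphi_G(a)\circ f$ for all $a\in A$. -}

module Defs where

open import Level using (Level; _⊔_)
open import Algebra.Bundles using (CommutativeRing)
open import Algebra.Morphism.Structures using (module RingMorphisms)
open import Data.Nat as ℕ using (ℕ; zero; suc; _≤_; _∸_)
open import Data.Product using (Σ; ∃; _×_; _,_; proj₁)

module _ {c ℓ} (R : CommutativeRing c ℓ) where
  open CommutativeRing R

  infixr 8 _^_
  _^_ : Carrier → ℕ → Carrier
  x ^ zero = 1#
  x ^ suc n = x * (x ^ n)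

  sumBelow : (ℕ → Carrier) → ℕ → Carrier
  sumBelow f zero = 0#
  sumBelow f (suc n) = sumBelow f n + f n

  natCast : ℕ → Carrier
  natCast zero = 0#
  natCast (suc n) = 1# + natCast n

  HasCharacteristic : ℕ → Set ℓ
  HasCharacteristic p = natCast p ≈ 0#

  Divides : Carrier → Carrier → Set (c ⊔ ℓ)
  Divides x y = ∃ λ z → y ≈ x * z

  IsUnit : Carrier → Set (c ⊔ ℓ)
  IsUnit x = ∃ λ u → u * x ≈ 1#

  module _ (π : Carrier) where
    TorsionFree : Set (c ⊔ ℓ)
    TorsionFree = ∀ x → π * x ≈ 0# → x ≈ 0#

    Separated : Set (c ⊔ ℓ)
    Separated = ∀ x → (∀ k → Divides (π ^ k) x) → x ≈ 0#

    IsCauchy : (ℕ → Carrier) → Set (c ⊔ ℓ)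
    IsCauchy x = ∀ k → ∃ λ N → ∀ m n → N ≤ m → N ≤ n → Divides (π ^ k) (x m - x n)

    ConvergesTo : (ℕ → Carrier) → Carrier → Set (c ⊔ ℓ)
    ConvergesTo x L = ∀ k → ∃ λ N → ∀ n → N ≤ n → Divides (π ^ k) (x n - L)

    IsPiAdicallyComplete : Set (c ⊔ ℓ)
    IsPiAdicallyComplete = Separated × (∀ x → IsCauchy x → ∃ (ConvergesTo x))

    TendsToZero : (ℕ → Carrier) → Set (c ⊔ ℓ)
    TendsToZero b = ∀ k → ∃ λ N → ∀ i → N ≤ i → Divides (π ^ k) (b i)

    -- R{τ}^ : sums Σ b_i τ^i with b_i → 0, represented by the coefficient sequence
    RTau : Set (c ⊔ ℓ)
    RTau = Σ (ℕ → Carrier) TendsToZero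

  coeff : {π : Carrier} → RTau π → ℕ → Carrier
  coeff = proj₁

  module _ (q : ℕ) where
    -- coefficient n of f ∘ g, using  bτ^i ∘ cτ^j = b c^{q^i} τ^{i+j}
    compCoeff : (ℕ → Carrier) → (ℕ → Carrier) → ℕ → Carrier
    compCoeff f g n = sumBelow (λ i → f i * (g (n ∸ i) ^ (q ℕ.^ i))) (suc n)

  addCoeff : (ℕ → Carrier) → (ℕ → Carrier) → ℕ → Carrier
  addCoeff f g n = f n + g n

  oneCoeff : ℕ → Carrier
  oneCoeff zero = 1#
  oneCoeff (suc n) = 0#

  _≋_ : (ℕ → Carrier) → (ℕ → Carrier) → Set ℓ
  f ≋ g = ∀ n → f n ≈ g n

-- Admissible A-module schemes over S = Spf R (with data A, θ : A → R, q, π).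
module _ {a ℓa c ℓ} (A : CommutativeRing a ℓa) (R : CommutativeRing c ℓ)
         (θ : CommutativeRing.Carrier A → CommutativeRing.Carrier R)
         (q : ℕ) (π : CommutativeRing.Carrier R) where
  private
    module A = CommutativeRing A
    module R = CommutativeRing R

  record AdmissibleModule : Set (a ⊔ ℓa ⊔ c ⊔ ℓ) where
    field
      φ : A.Carrier → RTau R π
      φ-cong : ∀ {x y} → x A.≈ y → _≋_ R (coeff R (φ x)) (coeff R (φ y))
      φ-+ : ∀ x y → _≋_ R (coeff R (φ (x A.+ y))) (addCoeff R (coeff R (φ x)) (coeff R (φ y)))
      φ-* : ∀ x y → _≋_ R (coeff R (φ (x A.* y))) (compCoeff R q (coeff R (φ x)) (coeff R (φ y)))
      φ-1 : _≋_ R (coeff R (φ A.1#)) (oneCoeff R)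
      φ-θ : ∀ x → coeff R (φ x) 0 R.≈ θ x

  open AdmissibleModule public

  IsALinear : AdmissibleModule → AdmissibleModule → RTau R π → Set (a ⊔ ℓ)
  IsALinear E G f = ∀ x → _≋_ R (compCoeff R q (coeff R f) (coeff R (φ E x)))
                                 (compCoeff R q (coeff R (φ G x)) (coeff R f))

module Submission where

-- Compare the τ^r-coefficients of f ∘ φ_E(t) = φ_G(t) ∘ f.  As φ_E(t) and φ_G(t) both
-- have constant term θ(t) = π, the coefficient b_r occurs only as b_r π^{q^r} on the left and
-- as π b_r on the right; isolating it gives the recursion.  The factor π − π^{q^r} cancels:
-- π is a non-zero-divisor, and 1 − π^m (m ≥ 1) is a unit because R is π-adically complete
-- (its inverse is the limit of the geometric series Σ π^{mn}).  Strong induction on r then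
-- shows that two A-linear morphisms with the same b₀ coincide.

open import Defs
open import Algebra.Bundles using (CommutativeRing)
open import Algebra.Morphism.Structures using (module RingMorphisms)
open import Data.Nat as ℕ using (ℕ; _≤_; _∸_)
open import Data.Nat.Primality using (Prime)
open import Data.Product using (_×_)

open import Data.Nat using (zero; suc; _<_; z≤n; s≤s)
open import Data.Nat.Base using (nonTrivial⇒n>1)
open import Data.Nat.Induction using (<-rec)
open import Data.Nat.Primality using (prime⇒nonTrivial)
import Data.Nat.Properties as ℕP
open import Data.Product using (_,_)
open import Function using (_∘_; _$_)
open import Level using (_⊔_)
open import Data.Sum using (inj₁; inj₂)
import Relation.Binary.PropositionalEquality as ≡
import Relation.Binary.Reasoning.Setoid as SetoidReasoning
import Algebra.Properties.AbelianGroup as AbelianGroupProperties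
import Algebra.Properties.CommutativeSemigroup as CommutativeSemigroupProperties
import Algebra.Properties.Group as GroupProperties
import Algebra.Properties.Ring as RingProperties

2≤m^n : ∀ {m n} → 2 ≤ m → 1 ≤ n → 2 ≤ m ℕ.^ n
2≤m^n {n = n} 2≤m 1≤n = ℕP.≤-trans (ℕP.^-monoʳ-≤ 2 1≤n) (ℕP.^-monoˡ-≤ n 2≤m)

module RingFacts {c ℓ} (R : CommutativeRing c ℓ) where
  open CommutativeRing R hiding (zero)
  open SetoidReasoning setoid
  open GroupProperties +-group using (x∙y⁻¹≈ε⇒x≈y; x≈y⇒x∙y⁻¹≈ε; ⁻¹-involutive)
  open AbelianGroupProperties +-abelianGroup using (⁻¹-∙-comm)
  open RingProperties ring using (x[y-z]≈xy-xz; [y-z]x≈yx-zx; -‿distribʳ-*)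
  open CommutativeSemigroupProperties +-commutativeSemigroup
    using (xy∙z≈xz∙y) renaming (interchange to +-interchange)
  open CommutativeSemigroupProperties *-commutativeSemigroup
    using () renaming (interchange to *-interchange)

  infixr 8 _^ᴿ_
  _^ᴿ_ : Carrier → ℕ → Carrier
  _^ᴿ_ = _^_ R

  sum : (ℕ → Carrier) → ℕ → Carrier
  sum = sumBelow R

  sub-+ : ∀ a b c d → (a + c) - (b + d) ≈ (a - b) + (c - d)
  sub-+ a b c d = trans (+-congˡ (sym (⁻¹-∙-comm b d))) (+-interchange a c (- b) (- d))

  sub-cancelˡ : ∀ a c d → (a + c) - (a + d) ≈ c - d
  sub-cancelˡ a c d = trans (sub-+ a a c d) (trans (+-congʳ (-‿inverseʳ a)) (+-identityˡ (c - d)))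

  sub-cancelʳ : ∀ a b c → (a + c) - (b + c) ≈ a - b
  sub-cancelʳ a b c = trans (sub-+ a b c c) (trans (+-congˡ (-‿inverseʳ c)) (+-identityʳ (a - b)))

  telescope : ∀ a b c → (a - b) + (b - c) ≈ a - c
  telescope a b c = begin
    (a - b) + (b - c)     ≈⟨ +-assoc a (- b) (b - c) ⟩
    a + (- b + (b - c))   ≈⟨ +-congˡ (sym (+-assoc (- b) b (- c))) ⟩
    a + ((- b + b) - c)   ≈⟨ +-congˡ (trans (+-congʳ (-‿inverseˡ b)) (+-identityˡ (- c))) ⟩
    a - c                 ∎

  isolate : ∀ X Y b P p → X + b * P ≈ Y + p * b → (p - P) * b ≈ X - Y
  isolate X Y b P p eq = begin
    (p - P) * b                ≈⟨ [y-z]x≈yx-zx b p P ⟩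
    p * b - P * b              ≈⟨ sub-cancelˡ Y (p * b) (P * b) ⟨
    (Y + p * b) - (Y + P * b)  ≈⟨ +-cong eq (-‿cong (+-congˡ (*-comm b P))) ⟨
    (X + b * P) - (Y + b * P)  ≈⟨ sub-cancelʳ X Y (b * P) ⟩
    X - Y                      ∎

  sum-cong : ∀ {g h : ℕ → Carrier} n → (∀ i → i < n → g i ≈ h i) → sum g n ≈ sum h n
  sum-cong zero    g≈h = refl
  sum-cong (suc n) g≈h = +-cong (sum-cong n (λ i i<n → g≈h i (ℕP.m<n⇒m<1+n i<n))) (g≈h n ℕP.≤-refl)

  sum-sub : ∀ (g h : ℕ → Carrier) n → sum (λ i → g i - h i) n ≈ sum g n - sum h n
  sum-sub g h zero    = sym (-‿inverseʳ 0#)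
  sum-sub g h (suc n) = trans (+-congʳ (sum-sub g h n)) (sym (sub-+ (sum g n) (sum h n) (g n) (h n)))

  sum-peel : ∀ (g : ℕ → Carrier) n → sum g (suc n) ≈ g 0 + sum (λ i → g (suc i)) n
  sum-peel g zero    = +-comm 0# (g 0)
  sum-peel g (suc n) = trans (+-congʳ (sum-peel g n)) (+-assoc (g 0) _ _)

  sum-reverse : ∀ (g : ℕ → Carrier) n → sum g n ≈ sum (λ j → g (n ∸ suc j)) n
  sum-reverse g zero    = refl
  sum-reverse g (suc n) = begin
    sum g n + g n                        ≈⟨ +-comm (sum g n) (g n) ⟩
    g n + sum g n                        ≈⟨ +-congˡ (sum-reverse g n) ⟩
    g n + sum (λ j → g (n ∸ suc j)) n    ≈⟨ sum-peel (λ j → g (n ∸ j)) n ⟨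
    sum (λ j → g (n ∸ j)) (suc n)        ∎

  pow-cong : ∀ {x y} n → x ≈ y → x ^ᴿ n ≈ y ^ᴿ n
  pow-cong zero    x≈y = refl
  pow-cong (suc n) x≈y = *-cong x≈y (pow-cong n x≈y)

  pow-+ : ∀ x m n → x ^ᴿ (m ℕ.+ n) ≈ x ^ᴿ m * x ^ᴿ n
  pow-+ x zero    n = sym (*-identityˡ (x ^ᴿ n))
  pow-+ x (suc m) n = trans (*-congˡ (pow-+ x m n)) (sym (*-assoc x (x ^ᴿ m) (x ^ᴿ n)))

  pow-* : ∀ x y n → (x * y) ^ᴿ n ≈ x ^ᴿ n * y ^ᴿ n
  pow-* x y zero    = sym (*-identityˡ 1#)
  pow-* x y (suc n) = trans (*-congˡ (pow-* x y n)) (*-interchange x y (x ^ᴿ n) (y ^ᴿ n))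

  geometricSum : Carrier → ℕ → Carrier
  geometricSum x = sum (x ^ᴿ_)

  geometricSum-telescopes : ∀ x n → geometricSum x n * (1# - x) ≈ 1# - x ^ᴿ n
  geometricSum-telescopes x zero    = trans (zeroˡ (1# - x)) (sym (-‿inverseʳ 1#))
  geometricSum-telescopes x (suc n) = begin
    (geometricSum x n + x ^ᴿ n) * (1# - x)              ≈⟨ distribʳ (1# - x) _ _ ⟩
    geometricSum x n * (1# - x) + x ^ᴿ n * (1# - x)     ≈⟨ +-cong (geometricSum-telescopes x n) (x[y-z]≈xy-xz (x ^ᴿ n) 1# x) ⟩
    (1# - x ^ᴿ n) + (x ^ᴿ n * 1# - x ^ᴿ n * x)          ≈⟨ +-congˡ (+-cong (*-identityʳ (x ^ᴿ n)) (-‿cong (*-comm (x ^ᴿ n) x))) ⟩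
    (1# - x ^ᴿ n) + (x ^ᴿ n - x ^ᴿ suc n)               ≈⟨ telescope 1# (x ^ᴿ n) (x ^ᴿ suc n) ⟩
    1# - x ^ᴿ suc n                                      ∎

  module PiAdic (π : Carrier) where

    -- π^k divides y, with witness; a record so that k can be inferred from the type.
    infix 4 π^_∣_
    record π^_∣_ (k : ℕ) (y : Carrier) : Set (c ⊔ ℓ) where
      constructor divides
      field
        quotient : Carrier
        equation : y ≈ π ^ᴿ k * quotient

    toDivides : ∀ {k y} → π^ k ∣ y → Divides R (π ^ᴿ k) y
    toDivides (divides z y≈) = z , y≈

    fromDivides : ∀ {k y} → Divides R (π ^ᴿ k) y → π^ k ∣ y
    fromDivides (z , y≈) = divides z y≈

    ∣-resp : ∀ {k a b} → a ≈ b → π^ k ∣ a → π^ k ∣ b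
    ∣-resp a≈b (divides z a≈πᵏz) = divides z $ trans (sym a≈b) a≈πᵏz

    ∣-+ : ∀ {k a b} → π^ k ∣ a → π^ k ∣ b → π^ k ∣ a + b
    ∣-+ {k} (divides z a≈) (divides w b≈) = divides (z + w) $ trans (+-cong a≈ b≈) (sym (distribˡ (π ^ᴿ k) z w))

    ∣-neg : ∀ {k a} → π^ k ∣ a → π^ k ∣ - a
    ∣-neg {k} (divides z a≈) = divides (- z) $ trans (-‿cong a≈) (-‿distribʳ-* (π ^ᴿ k) z)

    ∣-*ʳ : ∀ {k a} b → π^ k ∣ a → π^ k ∣ a * b
    ∣-*ʳ {k} b (divides z a≈) = divides (z * b) $ trans (*-congʳ a≈) (*-assoc (π ^ᴿ k) z b)

    ∣-≤ : ∀ {k n y} → k ≤ n → π^ n ∣ y → π^ k ∣ y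
    ∣-≤ {k} {n} k≤n (divides z y≈) = divides (π ^ᴿ (n ∸ k) * z) (begin
      _                               ≈⟨ y≈ ⟩
      π ^ᴿ n * z                      ≡⟨ ≡.cong (λ e → π ^ᴿ e * z) (ℕP.m+[n∸m]≡n k≤n) ⟨
      π ^ᴿ (k ℕ.+ (n ∸ k)) * z        ≈⟨ *-congʳ (pow-+ π k (n ∸ k)) ⟩
      π ^ᴿ k * π ^ᴿ (n ∸ k) * z       ≈⟨ *-assoc (π ^ᴿ k) (π ^ᴿ (n ∸ k)) z ⟩
      π ^ᴿ k * (π ^ᴿ (n ∸ k) * z)     ∎)

    ∣-pow : ∀ {x} n → Divides R π x → π^ n ∣ x ^ᴿ n
    ∣-pow {x} n (z , x≈πz) = divides (z ^ᴿ n) $ trans (pow-cong n x≈πz) (pow-* π z n)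

    -- For π ∣ x, the partial sums s n = Σ_{i<n} xⁱ of the geometric series form a π-adic
    -- Cauchy sequence, since s n − s k ∈ π^k R for k ≤ n.
    module _ {x} (π∣x : Divides R π x) where
      private
        s : ℕ → Carrier
        s = geometricSum x

      π^k∣xⁿ : ∀ {k n} → k ≤ n → π^ k ∣ x ^ᴿ n
      π^k∣xⁿ {n = n} k≤n = ∣-≤ k≤n (∣-pow n π∣x)

      geometricSum-tail : ∀ k n → k ≤ n → π^ k ∣ s n - s k
      geometricSum-tail k n k≤n with ℕP.m≤n⇒m<n∨m≡n k≤n
      ... | inj₂ ≡.refl = ∣-resp (sym (-‿inverseʳ (s k))) (divides 0# (sym (zeroʳ (π ^ᴿ k))))
      geometricSum-tail k (suc n) _ | inj₁ (s≤s k≤n) =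
        ∣-resp (xy∙z≈xz∙y (s n) (- s k) (x ^ᴿ n))
               (∣-+ (geometricSum-tail k n k≤n) (π^k∣xⁿ k≤n))

      geometricSum-cauchy : IsCauchy R π s
      geometricSum-cauchy k = k , λ m n k≤m k≤n → toDivides $
        ∣-resp (sub-cancelʳ (s m) (s n) (- s k)) (∣-+ (geometricSum-tail k m k≤m) (∣-neg (geometricSum-tail k n k≤n)))

      -- A limit L of the geometric series inverts 1 − x: for n large, L (1 − x) − 1 is
      -- − xⁿ − (s n − L)(1 − x) ∈ π^k R, so it lies in ⋂ π^k R = 0.
      geometricLimit-inverse : Separated R π → ∀ {L} → ConvergesTo R π s L → L * (1# - x) ≈ 1#
      geometricLimit-inverse separated {L} s→L = x∙y⁻¹≈ε⇒x≈y (L * w) 1# (separated (L * w - 1#) (toDivides ∘ π^k∣Lw-1))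
        where
        w : Carrier
        w = 1# - x

        split : ∀ S → (S * w - 1#) - (S - L) * w ≈ L * w - 1#
        split S = begin
          (S * w - 1#) - (S - L) * w           ≈⟨ +-congˡ (-‿cong ([y-z]x≈yx-zx w S L)) ⟩
          (S * w + - 1#) - (S * w + - (L * w)) ≈⟨ sub-cancelˡ (S * w) (- 1#) (- (L * w)) ⟩
          - 1# - - (L * w)                     ≈⟨ +-congˡ (⁻¹-involutive (L * w)) ⟩
          - 1# + L * w                         ≈⟨ +-comm (- 1#) (L * w) ⟩
          L * w - 1#                           ∎

        partial-error : ∀ n → s n * w - 1# ≈ - x ^ᴿ n
        partial-error n = begin
          s n * w - 1#            ≈⟨ +-congʳ (geometricSum-telescopes x n) ⟩
          (1# - x ^ᴿ n) - 1#      ≈⟨ xy∙z≈xz∙y 1# (- x ^ᴿ n) (- 1#) ⟩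
          (1# - 1#) - x ^ᴿ n      ≈⟨ trans (+-congʳ (-‿inverseʳ 1#)) (+-identityˡ (- x ^ᴿ n)) ⟩
          - x ^ᴿ n                ∎

        π^k∣Lw-1 : ∀ k → π^ k ∣ L * w - 1#
        π^k∣Lw-1 k with s→L k
        ... | N , close = ∣-resp (split (s n))
                (∣-+ (∣-resp (sym (partial-error n)) (∣-neg (π^k∣xⁿ (ℕP.m≤n+m k N))))
                     (∣-neg (∣-*ʳ w (fromDivides (close n (ℕP.m≤m+n N k))))))
          where
          n : ℕ
          n = N ℕ.+ k

    oneMinus-unit : IsPiAdicallyComplete R π → ∀ {x} → Divides R π x → IsUnit R (1# - x)
    oneMinus-unit (separated , converges) π∣x =
      let L , s→L = converges _ (geometricSum-cauchy π∣x)
      in  L , geometricLimit-inverse π∣x separated s→L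

    oneMinusπ^[Q-1]-unit : IsPiAdicallyComplete R π → ∀ {Q} → 2 ≤ Q → IsUnit R (1# - π ^ᴿ (Q ∸ 1))
    oneMinusπ^[Q-1]-unit complete {suc (suc m)} (s≤s (s≤s _)) = oneMinus-unit complete (π ^ᴿ m , refl)

    cancel-π·unit : TorsionFree R π → ∀ {u} → IsUnit R u → ∀ a b → (π * u) * a ≈ (π * u) * b → a ≈ b
    cancel-π·unit torsionFree {u} (v , vu≈1) a b πua≈πub = x∙y⁻¹≈ε⇒x≈y a b (begin
      a - b                ≈⟨ *-identityˡ (a - b) ⟨
      1# * (a - b)         ≈⟨ *-congʳ vu≈1 ⟨
      (v * u) * (a - b)    ≈⟨ *-assoc v u (a - b) ⟩
      v * (u * (a - b))    ≈⟨ *-congˡ (torsionFree (u * (a - b)) πu[a-b]≈0) ⟩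
      v * 0#               ≈⟨ zeroʳ v ⟩
      0#                   ∎)
      where
      πu[a-b]≈0 : π * (u * (a - b)) ≈ 0#
      πu[a-b]≈0 = begin
        π * (u * (a - b))                   ≈⟨ *-assoc π u (a - b) ⟨
        (π * u) * (a - b)                   ≈⟨ x[y-z]≈xy-xz (π * u) a b ⟩
        (π * u) * a - (π * u) * b           ≈⟨ x≈y⇒x∙y⁻¹≈ε πua≈πub ⟩
        0#                                  ∎

    cancel-π-π^Q : IsPiAdicallyComplete R π → TorsionFree R π → ∀ {Q} → 2 ≤ Q →
                   ∀ a b → (π - π ^ᴿ Q) * a ≈ (π - π ^ᴿ Q) * b → a ≈ b
    cancel-π-π^Q complete torsionFree {Q@(suc m)} 2≤Q a b eq =
      cancel-π·unit torsionFree (oneMinusπ^[Q-1]-unit complete 2≤Q) a b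
        (trans (*-congʳ (sym factor)) (trans eq (*-congʳ factor)))
      where
      factor : π - π ^ᴿ Q ≈ π * (1# - π ^ᴿ m)
      factor = trans (+-congʳ (sym (*-identityʳ π))) (sym (x[y-z]≈xy-xz π 1# (π ^ᴿ m)))

    module Recursion (q : ℕ) where

      recursionTerm : (b a c : ℕ → Carrier) → ℕ → ℕ → Carrier
      recursionTerm b a c r i = b i * a (r ∸ i) ^ᴿ (q ℕ.^ i) - c (r ∸ i) * b i ^ᴿ (q ℕ.^ (r ∸ i))

      coefficient-recursion : ∀ (b a c : ℕ → Carrier) r → a 0 ≈ π → c 0 ≈ π →
        compCoeff R q b a r ≈ compCoeff R q c b r →
        (π - π ^ᴿ (q ℕ.^ r)) * b r ≈ sum (recursionTerm b a c r) r
      coefficient-recursion b a c r a₀≈π c₀≈π linear =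
        trans (isolate X Y (b r) (π ^ᴿ (q ℕ.^ r)) π (begin
          X + b r * π ^ᴿ (q ℕ.^ r)   ≈⟨ +-congˡ (*-congˡ (pow-cong (q ℕ.^ r) (at-r∸r a a₀≈π))) ⟨
          compCoeff R q b a r        ≈⟨ linear ⟩
          compCoeff R q c b r        ≈⟨ reversed ⟩
          Y + π * b r                ∎))
          (sym (sum-sub _ _ r))
        where
        X Y : Carrier
        X = sum (λ i → b i * a (r ∸ i) ^ᴿ (q ℕ.^ i)) r
        Y = sum (λ j → c (r ∸ j) * b j ^ᴿ (q ℕ.^ (r ∸ j))) r

        at-r∸r : ∀ (e : ℕ → Carrier) → e 0 ≈ π → e (r ∸ r) ≈ π
        at-r∸r e e₀≈π = ≡.subst (λ k → e k ≈ π) (≡.sym (ℕP.n∸n≡0 r)) e₀≈π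

        -- The summands of c ∘ b, indexed by i, re-indexed by j = r − i.
        g : ℕ → Carrier
        g i = c i * b (r ∸ i) ^ᴿ (q ℕ.^ i)

        reindex : ∀ {j} → j ≤ r → g (r ∸ j) ≈ c (r ∸ j) * b j ^ᴿ (q ℕ.^ (r ∸ j))
        reindex {j} j≤r = reflexive (≡.cong (λ k → c (r ∸ j) * b k ^ᴿ (q ℕ.^ (r ∸ j))) (ℕP.m∸[m∸n]≡n j≤r))

        reversed : compCoeff R q c b r ≈ Y + π * b r
        reversed = begin
          compCoeff R q c b r                         ≈⟨ sum-reverse g (suc r) ⟩
          sum (λ j → g (r ∸ j)) r + g (r ∸ r)         ≈⟨ +-cong (sum-cong r (λ j j<r → reindex (ℕP.<⇒≤ j<r))) (reindex ℕP.≤-refl) ⟩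
          Y + c (r ∸ r) * b r ^ᴿ (q ℕ.^ (r ∸ r))      ≡⟨ ≡.cong (λ k → Y + c k * b r ^ᴿ (q ℕ.^ k)) (ℕP.n∸n≡0 r) ⟩
          Y + c 0 * (b r * 1#)                        ≈⟨ +-congˡ (*-cong c₀≈π (*-identityʳ (b r))) ⟩
          Y + π * b r                                 ∎

      recursion-determines : (∀ {r} → 1 ≤ r → ∀ x y → (π - π ^ᴿ (q ℕ.^ r)) * x ≈ (π - π ^ᴿ (q ℕ.^ r)) * y → x ≈ y) →
        ∀ (a c b b′ : ℕ → Carrier) →
        (∀ r → (π - π ^ᴿ (q ℕ.^ r)) * b r ≈ sum (recursionTerm b a c r) r) →
        (∀ r → (π - π ^ᴿ (q ℕ.^ r)) * b′ r ≈ sum (recursionTerm b′ a c r) r) →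
        b′ 0 ≈ b 0 → ∀ n → b′ n ≈ b n
      recursion-determines cancel a c b b′ recursion-b recursion-b′ b′₀≈b₀ = <-rec _ step
        where
        step : ∀ n → (∀ {i} → i < n → b′ i ≈ b i) → b′ n ≈ b n
        step zero    _  = b′₀≈b₀
        step (suc r) ih = cancel {suc r} (s≤s z≤n) (b′ (suc r)) (b (suc r)) (begin
          (π - π ^ᴿ (q ℕ.^ suc r)) * b′ (suc r)   ≈⟨ recursion-b′ (suc r) ⟩
          sum (recursionTerm b′ a c (suc r)) (suc r)
            ≈⟨ sum-cong (suc r) (λ i i<r → +-cong (*-congʳ (ih i<r))
                                                (-‿cong (*-congˡ (pow-cong (q ℕ.^ (suc r ∸ i)) (ih i<r))))) ⟩
          sum (recursionTerm b a c (suc r)) (suc r) ≈⟨ recursion-b (suc r) ⟨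
          (π - π ^ᴿ (q ℕ.^ suc r)) * b (suc r)    ∎)

proposition5p1 : ∀ {a ℓa c ℓ} (A : CommutativeRing a ℓa) (R : CommutativeRing c ℓ)
    (p h : ℕ) → Prime p → 1 ≤ h → HasCharacteristic R p →
    (θ : CommutativeRing.Carrier A → CommutativeRing.Carrier R) →
    RingMorphisms.IsRingHomomorphism (CommutativeRing.rawRing A) (CommutativeRing.rawRing R) θ →
    (t : CommutativeRing.Carrier A) (π : CommutativeRing.Carrier R) →
    CommutativeRing._≈_ R (θ t) π →
    TorsionFree R π → IsPiAdicallyComplete R π →
    (E G : AdmissibleModule A R θ (p ℕ.^ h) π) (f : RTau R π) →
    IsALinear A R θ (p ℕ.^ h) π E G f →
    (∀ (r : ℕ) → 1 ≤ r →
      IsUnit R (CommutativeRing._-_ R (CommutativeRing.1# R) (_^_ R π ((p ℕ.^ h) ℕ.^ r ∸ 1)))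
      × CommutativeRing._≈_ R
          (CommutativeRing._*_ R (CommutativeRing._-_ R π (_^_ R π ((p ℕ.^ h) ℕ.^ r))) (coeff R f r))
          (sumBelow R (λ i → CommutativeRing._-_ R
              (CommutativeRing._*_ R (coeff R f i) (_^_ R (coeff R (φ E t) (r ∸ i)) ((p ℕ.^ h) ℕ.^ i)))
              (CommutativeRing._*_ R (coeff R (φ G t) (r ∸ i)) (_^_ R (coeff R f i) ((p ℕ.^ h) ℕ.^ (r ∸ i)))))
            r))
    × (∀ (f′ : RTau R π) → IsALinear A R θ (p ℕ.^ h) π E G f′ →
        CommutativeRing._≈_ R (coeff R f′ 0) (coeff R f 0) →
        ∀ (n : ℕ) → CommutativeRing._≈_ R (coeff R f′ n) (coeff R f n))
proposition5p1 A R p h p-prime 1≤h _ θ _ t π θt≈π torsionFree complete E G f f-linear =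
  (λ r 1≤r → oneMinusπ^[Q-1]-unit complete (2≤q^ 1≤r) , recursion f f-linear r)
  , λ f′ f′-linear b′₀≈b₀ →
      recursion-determines (λ 1≤r → cancel-π-π^Q complete torsionFree (2≤q^ 1≤r))
        a c (coeff R f) (coeff R f′) (recursion f f-linear) (recursion f′ f′-linear) b′₀≈b₀
  where
  open CommutativeRing R using (_≈_; _-_; _*_; trans)
  open RingFacts R
  open PiAdic π
  q : ℕ
  q = p ℕ.^ h
  open Recursion q

  a c : ℕ → CommutativeRing.Carrier R
  a = coeff R (φ E t)
  c = coeff R (φ G t)

  2≤q^ : ∀ {r} → 1 ≤ r → 2 ≤ q ℕ.^ r
  2≤q^ = 2≤m^n (2≤m^n (nonTrivial⇒n>1 p {{prime⇒nonTrivial p-prime}}) 1≤h)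

  recursion : ∀ g → IsALinear A R θ q π E G g → ∀ r →
              (π - π ^ᴿ (q ℕ.^ r)) * coeff R g r ≈ sum (recursionTerm (coeff R g) a c r) r
  recursion g g-linear r = coefficient-recursion (coeff R g) a c r
    (trans (φ-θ E t) θt≈π) (trans (φ-θ G t) θt≈π) (g-linear t r)
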